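{- For every integer $t_0\geq 1$ and every $\varepsilon>0$, there is a finite graph $G$ for which player $\mathbf{B}$ has a strategy in the Voronoi game on $G$ such that, whatever $\mathbf{A}$ plays, after each of the rounds $k=1,\dots,t_0$ player $\mathbf{B}$ controls at least $(1-\varepsilon)|V(G)|$ vertices, i.e. at least $(1-\varepsilon)|V(G)|$ vertices of $G$ are strictly closer to the set of vertices claimed by $\mathbf{B}$ in the first $k$ rounds than to the set of vertices claimed by $\mathbf{A}$ in the first $k$ rounds.
   Context: The discrete Voronoi game on a finite graph $G$: two players $\mathbf{A}$ and $\mathbf{B}$ alternately claim vertices of $G$, $\mathbf{A}$ first; in each round $\mathbf{A}$ claims one vertex and then $\mathbf{B}$ claims one vertex; no vertex may be claimed twice. Distances are shortest-path distances in $G$; the distance from a vertex to a set is the minimum distance to an element of the set. A player controls a vertex (at a given moment) if it is strictly closer to that player's claimed vertices than to the other player's claimed vertices. -}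

module Defs where

open import Data.Nat using (ℕ; zero; suc; _≤_)
open import Data.Fin using (Fin)
open import Data.Bool using (Bool; true; false)
open import Data.List using (List; []; _∷_; map; length)
open import Data.List.Membership.Propositional using (_∈_; _∉_)
open import Data.List.Relation.Unary.All using (All)
open import Data.List.Relation.Unary.Unique.Propositional using (Unique)
open import Data.Product using (Σ; ∃; ∃-syntax; _×_; _,_; proj₁; proj₂)
open import Data.Integer using (+_)
open import Data.Rational using (ℚ; _/_; _-_; _*_; 1ℚ) renaming (_≤_ to _≤ℚ_)
open import Relation.Binary.PropositionalEquality using (_≡_; _≢_)
open import Relation.Nullary using (¬_)
open import Data.Sum using (_⊎_)

record Graph (n : ℕ) : Set where
  field
    adj   : Fin n → Fin n → Bool
    sym   : ∀ u v → adj u v ≡ adj v u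
    irrefl : ∀ v → adj v v ≡ false
open Graph public

data Walk {n : ℕ} (G : Graph n) : Fin n → Fin n → ℕ → Set where
  here : ∀ {u} → Walk G u u 0
  step : ∀ {u w v d} → adj G u w ≡ true → Walk G w v d → Walk G u v (suc d)

-- dist_G(v, S) ≤ d  (shortest-path distance from v to the set S is at most d;
-- false whenever S is empty or unreachable, i.e. distance ∞).
DistLe : ∀ {n} → Graph n → Fin n → List (Fin n) → ℕ → Set
DistLe G v S d = ∃[ s ] (s ∈ S × ∃[ d' ] (d' ≤ d × Walk G v s d'))

StrictlyCloser : ∀ {n} → Graph n → List (Fin n) → List (Fin n) → Fin n → Set
StrictlyCloser G Bs As v = ∃[ d ] (DistLe G v Bs d × ¬ DistLe G v As d)

-- A history of the game: list of completed rounds (A's vertex, B's vertex),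
-- most recent round first.
History : ℕ → Set
History n = List (Fin n × Fin n)

claimedA : ∀ {n} → History n → List (Fin n)
claimedA h = map proj₁ h

claimedB : ∀ {n} → History n → List (Fin n)
claimedB h = map proj₂ h

Claimed : ∀ {n} → History n → Fin n → Set
Claimed h v = (v ∈ claimedA h) ⊎ (v ∈ claimedB h)

BStrategy : ℕ → Set
BStrategy n = History n → Fin n → Fin n

data Reachable {n : ℕ} (σ : BStrategy n) : History n → Set where
  start : Reachable σ []
  round : ∀ {h a} → Reachable σ h → ¬ Claimed h a → Reachable σ ((a , σ h a) ∷ h)

AtLeast : ∀ {n} → ℚ → (Fin n → Set) → Set
AtLeast {n} q P = ∃[ vs ] (Unique vs × All P vs × q ≤ℚ (+ length vs / 1))

BControlsAtLeast : ∀ {n} → Graph n → ℚ → History n → Set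
BControlsAtLeast {n} G ε h =
  AtLeast ((1ℚ - ε) * (+ n / 1)) (StrictlyCloser G (claimedB h) (claimedA h))

module Submission where

-- The graph consists of m clusters, each a star of N leaves around a centre, and m hubs; hub i is
-- joined to the centre of cluster j by a path of length len i j = m + ((i − j) mod m).  B answers a
-- move in cluster j by hub j, and a move at hub i or on a path to hub i by hub i − 1, which is
-- strictly closer than hub i to every cluster other than i.  Each move of A therefore spoils at
-- most two clusters, and every leaf of an unspoiled cluster is strictly closer to B's vertices
-- than to A's: a 1-Lipschitz lower bound for the distance from the leaf shows that each A-vertex
-- is farther from it than B's answer.  The leaves form all but a 1/(m + 1) fraction of the
-- vertices, so choosing m ≥ (2t₀ + 1)/ε makes B control a (1 − ε) fraction for t₀ rounds.

open import Defs hiding (sym)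
open import Data.Nat as ℕ using (ℕ; zero; suc; _≤_; _<_; _*_; _+_; _∸_; _⊓_; z≤n; s≤s; s≤s⁻¹; _≤?_; NonZero)
open import Data.Nat.Properties
import Data.Nat.Tactic.RingSolver as ℕ-Solver
open import Data.Fin using (Fin; zero; suc; toℕ; fromℕ; fromℕ<; inject₁; combine; remQuot; splitAt; _↑ˡ_; _↑ʳ_)
import Data.Fin.Properties as Fin
open import Data.Integer as ℤ using (ℤ; +[1+_]; _⊖_)
import Data.Integer.Properties as ℤ
import Data.Integer.Tactic.RingSolver as ℤ-Solver
open import Data.Rational as ℚ using (ℚ; mkℚ; _/_; 1ℚ; Positive; toℚᵘ)
open import Data.Rational.Properties using (toℚᵘ-cancel-≤; toℚᵘ-homo-*; toℚᵘ-homo-+; toℚᵘ-homo‿-; toℚᵘ-fromℚᵘ)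
import Data.Rational.Unnormalised as ℚᵘ
import Data.Rational.Unnormalised.Properties as ℚᵘ
open import Data.Bool using (true; _∨_)
open import Data.Bool.Properties using (∨-comm)
open import Data.List using (List; []; _∷_; length; map; filter; allFin; cartesianProductWith; _++_)
open import Data.List.Properties using (length-++; length-map; length-removeAt′; length-tabulate)
open import Data.List.Membership.Propositional using (_∈_; _∉_)
open import Data.List.Membership.Propositional.Properties
  using (∈-filter⁻; ∈-++⁺ˡ; ∈-++⁺ʳ; ∈-map⁺; ∈-cartesianProductWith⁻)
import Data.List.Membership.DecPropositional as DecMembership
open import Data.List.Relation.Unary.Any using (here; there; index; _─_)
open import Data.List.Relation.Unary.All as All using (All; []; _∷_)
open import Data.List.Relation.Unary.AllPairs using ([]; _∷_)
open import Data.List.Relation.Unary.Unique.Propositional using (Unique)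
import Data.List.Relation.Unary.Unique.Propositional.Properties as Unique
open import Data.Product using (∃; ∃-syntax; _×_; _,_; proj₁; proj₂; uncurry)
open import Data.Sum using (_⊎_; inj₁; inj₂; [_,_])
open import Data.Empty using (⊥-elim)
open import Function using (id; _∘_)
open import Level using (0ℓ)
open import Relation.Binary.PropositionalEquality hiding ([_])
open import Relation.Binary.Definitions using (DecidableEquality)
open import Relation.Nullary using (¬_; Dec; yes; no; ¬?; does)
open import Relation.Nullary.Decidable using (_⊎-dec_; dec-true; dec-false)
open import Relation.Unary using (Pred; Decidable)

module _ {A : Set} where

  ∈-─ : ∀ {x y : A} {ys} (x∈ys : x ∈ ys) → y ∈ ys → y ≢ x → y ∈ (ys ─ x∈ys)
  ∈-─ (here refl)  (here refl)  y≢x = ⊥-elim (y≢x refl)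
  ∈-─ (here refl)  (there y∈ys) _   = y∈ys
  ∈-─ (there _)    (here refl)  _   = here refl
  ∈-─ (there x∈ys) (there y∈ys) y≢x = there (∈-─ x∈ys y∈ys y≢x)

  Unique-⊆⇒length≤ : ∀ {xs ys : List A} → Unique xs → (∀ {x} → x ∈ xs → x ∈ ys) →
                     length xs ≤ length ys
  Unique-⊆⇒length≤ {[]}     _            _     = z≤n
  Unique-⊆⇒length≤ {x ∷ xs} {ys} (x∉xs ∷ xs!) xs⊆ys = begin
    suc (length xs)          ≤⟨ s≤s (Unique-⊆⇒length≤ xs! xs⊆ys─x) ⟩
    suc (length (ys ─ x∈ys)) ≡⟨ sym (length-removeAt′ ys (index x∈ys)) ⟩
    length ys                ∎
    where
    open ≤-Reasoning
    x∈ys = xs⊆ys (here refl)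
    xs⊆ys─x : ∀ {y} → y ∈ xs → y ∈ (ys ─ x∈ys)
    xs⊆ys─x y∈xs = ∈-─ x∈ys (xs⊆ys (there y∈xs)) (λ y≡x → All.lookup x∉xs y∈xs (sym y≡x))

  length-filter+filter-∁ : ∀ {P : Pred A 0ℓ} (P? : Decidable P) xs →
                           length (filter P? xs) + length (filter (λ x → ¬? (P? x)) xs) ≡ length xs
  length-filter+filter-∁ P? []       = refl
  length-filter+filter-∁ P? (x ∷ xs) with P? x
  ... | yes _ = cong suc (length-filter+filter-∁ P? xs)
  ... | no  _ = trans (+-suc _ _) (cong suc (length-filter+filter-∁ P? xs))

module _ {A : Set} (_≟ᴬ_ : DecidableEquality A) where
  open DecMembership _≟ᴬ_ using (_∈?_)

  length∸≤length-filter-∉ : ∀ {xs} ys → Unique xs →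
                             length xs ∸ length ys ≤ length (filter (λ x → ¬? (x ∈? ys)) xs)
  length∸≤length-filter-∉ {xs} ys xs! = m≤n+o⇒m∸n≤o (length xs) (length ys) (begin
    length xs               ≡⟨ sym (length-filter+filter-∁ (_∈? ys) xs) ⟩
    length ∈ys + length ∉ys ≤⟨ +-monoˡ-≤ (length ∉ys) ∈ys≤ys ⟩
    length ys + length ∉ys  ∎)
    where
    open ≤-Reasoning
    ∈ys = filter (_∈? ys) xs
    ∉ys = filter (λ x → ¬? (x ∈? ys)) xs
    ∈ys≤ys : length ∈ys ≤ length ys
    ∈ys≤ys = Unique-⊆⇒length≤ (Unique.filter⁺ (_∈? ys) xs!) (proj₂ ∘ ∈-filter⁻ (_∈? ys) {xs = xs})

length-cartesianProductWith : ∀ {A B C : Set} (f : A → B → C) xs ys →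
                              length (cartesianProductWith f xs ys) ≡ length xs * length ys
length-cartesianProductWith f []       ys = refl
length-cartesianProductWith f (x ∷ xs) ys = begin
  length (map (f x) ys ++ cartesianProductWith f xs ys)         ≡⟨ length-++ (map (f x) ys) ⟩
  length (map (f x) ys) + length (cartesianProductWith f xs ys) ≡⟨ cong₂ _+_ (length-map (f x) ys)
                                                                     (length-cartesianProductWith f xs ys) ⟩
  length ys + length xs * length ys                             ∎
  where open ≡-Reasoning

module _ {n : ℕ} where
  open DecMembership (Fin._≟_ {n}) using (_∈?_)

  ∃-∉-of-length< : (xs : List (Fin n)) → length xs < n → ∃ λ x → x ∉ xs
  ∃-∉-of-length< xs len<n with Fin.any? (λ x → ¬? (x ∈? xs))
  ... | yes x∉xs = x∉xs
  ... | no ¬x∉xs = ⊥-elim (<⇒≱ len<n (begin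
    n                 ≡⟨ sym (length-tabulate id) ⟩
    length (allFin n) ≤⟨ Unique-⊆⇒length≤ (Unique.allFin⁺ n) (λ {x} _ → all∈xs x) ⟩
    length xs         ∎))
    where
    open ≤-Reasoning
    all∈xs : ∀ x → x ∈ xs
    all∈xs x with x ∈? xs
    ... | yes x∈xs = x∈xs
    ... | no  x∉xs = ⊥-elim (¬x∉xs (x , x∉xs))

Near : ℕ → ℕ → Set
Near a b = a ≤ suc b × b ≤ suc a

Near-refl : ∀ a → Near a a
Near-refl a = n≤1+n a , n≤1+n a

Near-suc : ∀ a → Near a (suc a)
Near-suc a = m≤n⇒m≤1+n (n≤1+n a) , ≤-refl

Near-∸-suc : ∀ a b → Near (a ∸ b) (a ∸ suc b)
Near-∸-suc a b rewrite sym (pred[m∸n]≡m∸[1+n] a b) with a ∸ b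
... | zero  = z≤n , z≤n
... | suc c = ≤-refl , m≤n⇒m≤1+n (n≤1+n c)

Near-+ˡ : ∀ c {a b} → Near a b → Near (c + a) (c + b)
Near-+ˡ c (a≤1+b , b≤1+a) = ≤-trans (+-monoʳ-≤ c a≤1+b) (≤-reflexive (+-suc c _)) ,
                            ≤-trans (+-monoʳ-≤ c b≤1+a) (≤-reflexive (+-suc c _))

Near-⊓ : ∀ {a a′ b b′} → Near a a′ → Near b b′ → Near (a ⊓ b) (a′ ⊓ b′)
Near-⊓ (a≤ , a′≤) (b≤ , b′≤) = ⊓-mono-≤ a≤ b≤ , ⊓-mono-≤ a′≤ b′≤

module _ {n : ℕ} (G : Graph n) where

  Lipschitz : (Fin n → ℕ) → Set
  Lipschitz φ = ∀ {x y} → adj G x y ≡ true → φ y ≤ suc (φ x)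

  Lipschitz-walk : ∀ {φ} → Lipschitz φ → ∀ {u s d} → Walk G u s d → φ s ≤ φ u + d
  Lipschitz-walk {φ} lip {u} here = ≤-reflexive (sym (+-identityʳ (φ u)))
  Lipschitz-walk {φ} lip {u} {s} {suc d} (step {w = w} u~w W) = begin
    φ s           ≤⟨ Lipschitz-walk lip W ⟩
    φ w + d       ≤⟨ +-monoˡ-≤ d (lip u~w) ⟩
    suc (φ u) + d ≡⟨ sym (+-suc (φ u) d) ⟩
    φ u + suc d   ∎
    where open ≤-Reasoning

  DistGt : Fin n → Fin n → ℕ → Set
  DistGt v x w = ∀ {d} → Walk G v x d → w < d

  DistGt-mono : ∀ {v x w w′} → w′ ≤ w → DistGt v x w → DistGt v x w′
  DistGt-mono w′≤w x>w W = ≤-<-trans w′≤w (x>w W)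

  -- Every walk out of v first steps to a neighbour, where φ vanishes.
  Lipschitz⇒DistGt : ∀ {φ v x} → Lipschitz φ → (∀ y → adj G v y ≡ true → φ y ≡ 0) →
                     x ≢ v → DistGt v x (φ x)
  Lipschitz⇒DistGt lip φ≡0 x≢v here = ⊥-elim (x≢v refl)
  Lipschitz⇒DistGt {φ} {x = x} lip φ≡0 x≢v (step v~y W) =
    s≤s (subst (λ z → φ x ≤ z + _) (φ≡0 _ v~y) (Lipschitz-walk lip W))

module Answering {n : ℕ} (G : Graph n) (β : Fin n → Fin n) (β≢ : ∀ a → β a ≢ a) (fallback : Fin n) where
  open DecMembership (Fin._≟_ {n}) using (_∈?_)

  claimed? : ∀ h x → Dec (Claimed h x)
  claimed? h x = (x ∈? claimedA h) ⊎-dec (x ∈? claimedB h)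

  unclaimed : List (Fin n) → Fin n
  unclaimed xs with Fin.any? (λ x → ¬? (x ∈? xs))
  ... | yes (x , _) = x
  ... | no  _       = fallback

  unclaimed-∉ : ∀ xs → length xs < n → unclaimed xs ∉ xs
  unclaimed-∉ xs len<n with Fin.any? (λ x → ¬? (x ∈? xs))
  ... | yes (_ , x∉xs) = x∉xs
  ... | no  ¬∃x∉xs     = ⊥-elim (¬∃x∉xs (∃-∉-of-length< xs len<n))

  σ : BStrategy n
  σ h a with claimed? h (β a)
  ... | no  _ = β a
  ... | yes _ = unclaimed (a ∷ claimedA h ++ claimedB h)

  σ-legal : ∀ h a → suc (length h + length h) < n → ¬ Claimed h a →
            ¬ Claimed h (σ h a) × σ h a ≢ a
  σ-legal h a len<n a-free with claimed? h (β a)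
  ... | no  βa-free = βa-free , β≢ a
  ... | yes _       = [ x∉ ∘ there ∘ ∈-++⁺ˡ , x∉ ∘ there ∘ ∈-++⁺ʳ (claimedA h) ] , x∉ ∘ here
    where
    xs = a ∷ claimedA h ++ claimedB h
    length-xs : length xs ≡ suc (length h + length h)
    length-xs = cong suc (trans (length-++ (claimedA h)) (cong₂ _+_ (length-map _ h) (length-map _ h)))
    x∉ : unclaimed xs ∉ xs
    x∉ = unclaimed-∉ xs (subst (_< n) (sym length-xs) len<n)

  module _ (v : Fin n) where

    Beats : Fin n → Set
    Beats a = ∃[ w ] (Walk G v (β a) w × DistGt G v a w)

    BAhead : History n → Set
    BAhead h = ∃[ b ] (b ∈ claimedB h × ∃[ w ] (Walk G v b w × All (λ a → DistGt G v a w) (claimedA h)))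

    BAhead-cons : ∀ {h a b c w₀} → c ∈ claimedB ((a , b) ∷ h) → Walk G v c w₀ → DistGt G v a w₀ →
                  BAhead h → BAhead ((a , b) ∷ h)
    BAhead-cons {c = c} {w₀} c∈ W₀ a>w₀ (b , b∈ , w , W , As>w) with w ≤? w₀
    ... | yes w≤w₀ = b , there b∈ , w , W , DistGt-mono G w≤w₀ a>w₀ ∷ As>w
    ... | no  w≰w₀ = c , c∈ , w₀ , W₀ , a>w₀ ∷ All.map (DistGt-mono G (<⇒≤ (≰⇒> w≰w₀))) As>w

    -- If A already holds β a, then B's current witness is closer than β a, hence than a.
    BAhead-step : ∀ {h a} → BAhead h → Beats a → BAhead ((a , σ h a) ∷ h)
    BAhead-step {h} {a} ahead (w₀ , W₀ , a>w₀) with claimed? h (β a)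
    ... | no  _           = BAhead-cons (here refl) W₀ a>w₀ ahead
    ... | yes (inj₂ βa∈B) = BAhead-cons (there βa∈B) W₀ a>w₀ ahead
    ... | yes (inj₁ βa∈A) = let (b , b∈ , w , W , As>w) = ahead in
      b , there b∈ , w , W , DistGt-mono G (<⇒≤ (All.lookup As>w βa∈A W₀)) a>w₀ ∷ As>w

    BAhead-reachable : ∀ {h a} → Reachable σ h → All Beats (claimedA ((a , σ h a) ∷ h)) →
                       BAhead ((a , σ h a) ∷ h)
    BAhead-reachable {a = a} start ((w₀ , W₀ , a>w₀) ∷ []) = β a , here refl , w₀ , W₀ , a>w₀ ∷ []
    BAhead-reachable (round R _) (a-beaten ∷ beaten) = BAhead-step (BAhead-reachable R beaten) a-beaten

    BAhead⇒StrictlyCloser : ∀ {h} → BAhead h → StrictlyCloser G (claimedB h) (claimedA h) v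
    BAhead⇒StrictlyCloser (b , b∈ , w , W , As>w) =
      w , (b , b∈ , w , ≤-refl , W) , λ (a , a∈ , d , d≤w , W′) → <⇒≱ (All.lookup As>w a∈ W′) d≤w

leaf-fraction : ∀ p q m T B → 1 ≤ p → T ≤ m → q * suc T ≤ suc m →
                q * (suc m * B) ≤ q * ((m ∸ T) * B) + p * (suc m * B)
leaf-fraction p q m T B 1≤p T≤m q[1+T]≤1+m = begin
  q * (suc m * B)                     ≡⟨ cong (λ x → q * (suc x * B)) (sym (m∸n+n≡m T≤m)) ⟩
  q * (suc (m ∸ T + T) * B)           ≡⟨ distrib q (m ∸ T) T B ⟩
  q * ((m ∸ T) * B) + q * suc T * B   ≤⟨ +-monoʳ-≤ (q * ((m ∸ T) * B)) (*-monoˡ-≤ B q[1+T]≤1+m) ⟩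
  q * ((m ∸ T) * B) + suc m * B       ≡⟨ cong (q * ((m ∸ T) * B) +_) (sym (*-identityˡ (suc m * B))) ⟩
  q * ((m ∸ T) * B) + 1 * (suc m * B) ≤⟨ +-monoʳ-≤ (q * ((m ∸ T) * B)) (*-monoˡ-≤ (suc m * B) 1≤p) ⟩
  q * ((m ∸ T) * B) + p * (suc m * B) ∎
  where
  open ≤-Reasoning
  distrib : ∀ q x T B → q * ((1 + (x + T)) * B) ≡ q * (x * B) + q * (1 + T) * B
  distrib = ℕ-Solver.solve-∀

1≤∣numerator∣ : ∀ ε → Positive ε → 1 ≤ ℤ.∣ ℚ.numerator ε ∣
1≤∣numerator∣ (mkℚ +[1+ _ ] _ _) _ = s≤s z≤n

1-ε-bound : ∀ ε → Positive ε → ∀ n ℓ →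
            ℚ.denominatorℕ ε * n ≤ ℚ.denominatorℕ ε * ℓ + ℤ.∣ ℚ.numerator ε ∣ * n →
            (1ℚ ℚ.- ε) ℚ.* (ℤ.+ n / 1) ℚ.≤ ℤ.+ ℓ / 1
1-ε-bound ε@(mkℚ +[1+ p ] d _) _ n ℓ qn≤qℓ+pn = toℚᵘ-cancel-≤
  (ℚᵘ.≤-respˡ-≃ (ℚᵘ.≃-sym lhs≃) (ℚᵘ.≤-respʳ-≃ (ℚᵘ.≃-sym (toℚᵘ-fromℚᵘ ℓᵘ)) (ℚᵘ.*≤* cross)))
  where
  q = suc d
  nᵘ = ℚᵘ.mkℚᵘ (ℤ.+ n) 0
  ℓᵘ = ℚᵘ.mkℚᵘ (ℤ.+ ℓ) 0
  lhsᵘ = (toℚᵘ 1ℚ ℚᵘ.+ ℚᵘ.- toℚᵘ ε) ℚᵘ.* nᵘ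
  lhs≃ : toℚᵘ ((1ℚ ℚ.- ε) ℚ.* (ℤ.+ n / 1)) ℚᵘ.≃ lhsᵘ
  lhs≃ = ℚᵘ.≃-trans (toℚᵘ-homo-* (1ℚ ℚ.- ε) (ℤ.+ n / 1))
           (ℚᵘ.*-cong (ℚᵘ.≃-trans (toℚᵘ-homo-+ 1ℚ (ℚ.- ε)) (ℚᵘ.+-congʳ (toℚᵘ 1ℚ) (toℚᵘ-homo‿- ε)))
                      (toℚᵘ-fromℚᵘ nᵘ))
  numerator-lhs : ∀ (q p n : ℤ) → ((ℤ.+ 1 ℤ.* q ℤ.+ ℤ.- p ℤ.* ℤ.+ 1) ℤ.* n) ℤ.* ℤ.+ 1 ≡ q ℤ.* n ℤ.- p ℤ.* n
  numerator-lhs = ℤ-Solver.solve-∀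
  cross : ℚᵘ.↥ lhsᵘ ℤ.* ℚᵘ.↧ ℓᵘ ℤ.≤ ℚᵘ.↥ ℓᵘ ℤ.* ℚᵘ.↧ lhsᵘ
  cross = begin
    ℚᵘ.↥ lhsᵘ ℤ.* ℚᵘ.↧ ℓᵘ                   ≡⟨ numerator-lhs (ℤ.+ q) +[1+ p ] (ℤ.+ n) ⟩
    ℤ.+ q ℤ.* ℤ.+ n ℤ.- +[1+ p ] ℤ.* ℤ.+ n ≡⟨ cong₂ ℤ._-_ (sym (ℤ.pos-* q n)) (sym (ℤ.pos-* (suc p) n)) ⟩
    ℤ.+ (q * n) ℤ.- ℤ.+ (suc p * n)         ≡⟨ ℤ.[+m]-[+n]≡m⊖n (q * n) (suc p * n) ⟩
    q * n ⊖ suc p * n                       ≤⟨ ℤ.⊖-monoˡ-≤ (suc p * n) qn≤qℓ+pn ⟩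
    q * ℓ + suc p * n ⊖ suc p * n           ≡⟨ ℤ.≤-⊖ (m≤n+m (suc p * n) (q * ℓ)) ⟩
    ℤ.+ (q * ℓ + suc p * n ∸ suc p * n)     ≡⟨ cong ℤ.+_ (trans (m+n∸n≡m (q * ℓ) (suc p * n)) (*-comm q ℓ)) ⟩
    ℤ.+ (ℓ * q)                             ≡⟨ ℤ.pos-* ℓ q ⟩
    ℤ.+ ℓ ℤ.* ℤ.+ q                         ≡⟨ cong (λ z → ℤ.+ ℓ ℤ.* ℤ.+ z)
                                                 (sym (trans (*-identityʳ (1 * q)) (*-identityˡ q))) ⟩
    ℚᵘ.↥ ℓᵘ ℤ.* ℚᵘ.↧ lhsᵘ                   ∎
    where open ℤ.≤-Reasoning

module Construction (M : ℕ) where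

  m K Q N n : ℕ
  m = suc (suc M)
  K = m + m
  Q = suc (suc (m * K))
  N = m * Q
  n = m * (N + Q)

  data V : Set where
    leaf   : Fin m → Fin N → V
    centre : Fin m → V
    hub    : Fin m → V
    path   : Fin m → Fin m → Fin K → V

  enc : V → Fin n
  enc (leaf j t)   = combine j (t ↑ˡ Q)
  enc (centre j)   = combine j (N ↑ʳ zero)
  enc (hub j)      = combine j (N ↑ʳ suc zero)
  enc (path i j k) = combine j (N ↑ʳ suc (suc (combine i k)))

  decPath : Fin m → Fin m × Fin K → V
  decPath j (i , k) = path i j k

  decBlock : Fin m → Fin N ⊎ Fin Q → V
  decBlock j (inj₁ t)              = leaf j t
  decBlock j (inj₂ zero)           = centre j
  decBlock j (inj₂ (suc zero))     = hub j
  decBlock j (inj₂ (suc (suc ik))) = decPath j (remQuot K ik)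

  decSplit : Fin m × Fin (N + Q) → V
  decSplit (j , r) = decBlock j (splitAt N r)

  dec : Fin n → V
  dec x = decSplit (remQuot (N + Q) x)

  dec-enc : ∀ u → dec (enc u) ≡ u
  dec-enc (leaf j t)   = trans (cong decSplit (Fin.remQuot-combine j (t ↑ˡ Q)))
                               (cong (decBlock j) (Fin.splitAt-↑ˡ N t Q))
  dec-enc (centre j)   = trans (cong decSplit (Fin.remQuot-combine j (N ↑ʳ zero)))
                               (cong (decBlock j) (Fin.splitAt-↑ʳ N Q zero))
  dec-enc (hub j)      = trans (cong decSplit (Fin.remQuot-combine j (N ↑ʳ suc zero)))
                               (cong (decBlock j) (Fin.splitAt-↑ʳ N Q (suc zero)))
  dec-enc (path i j k) = trans (cong decSplit (Fin.remQuot-combine j (N ↑ʳ ik)))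
    (trans (cong (decBlock j) (Fin.splitAt-↑ʳ N Q ik)) (cong (decPath j) (Fin.remQuot-combine i k)))
    where ik = suc (suc (combine i k))

  enc-injective : ∀ {u u′} → enc u ≡ enc u′ → u ≡ u′
  enc-injective {u} {u′} eq = trans (sym (dec-enc u)) (trans (cong dec eq) (dec-enc u′))

  offset : ℕ → ℕ → ℕ
  offset a b with b ≤? a
  ... | yes _ = a ∸ b
  ... | no  _ = m + a ∸ b

  offset-≤ : ∀ {a b} → b ≤ a → offset a b ≡ a ∸ b
  offset-≤ {a} {b} b≤a with b ≤? a
  ... | yes _   = refl
  ... | no  b≰a = ⊥-elim (b≰a b≤a)

  offset-> : ∀ {a b} → a < b → offset a b ≡ m + a ∸ b
  offset-> {a} {b} a<b with b ≤? a
  ... | yes b≤a = ⊥-elim (<⇒≱ a<b b≤a)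
  ... | no  _   = refl

  offset<m : ∀ {a} b → a < m → offset a b < m
  offset<m {a} b a<m with b ≤? a
  ... | yes _   = ≤-<-trans (m∸n≤m a b) a<m
  ... | no  b≰a = m<n+o⇒m∸n<o (m + a) b (begin-strict
    m + a ≡⟨ +-comm m a ⟩
    a + m <⟨ +-monoˡ-< m (≰⇒> b≰a) ⟩
    b + m ∎)
    where open ≤-Reasoning

  prev : Fin m → Fin m
  prev zero    = fromℕ (suc M)
  prev (suc i) = inject₁ i

  prev≢ : ∀ i → prev i ≢ i
  prev≢ zero    ()
  prev≢ (suc i) eq = <-irrefl (trans (sym (Fin.toℕ-inject₁ i)) (cong toℕ eq)) ≤-refl

  offset-prev : ∀ {i j} → i ≢ j → suc (offset (toℕ (prev i)) (toℕ j)) ≡ offset (toℕ i) (toℕ j)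
  offset-prev {zero} {zero}  0≢0 = ⊥-elim (0≢0 refl)
  offset-prev {zero} {suc j} _ rewrite Fin.toℕ-fromℕ (suc M) = begin
    suc (offset (suc M) (suc b)) ≡⟨ cong suc (offset-≤ 1+b≤1+M) ⟩
    suc (suc M ∸ suc b)          ≡⟨ sym (+-∸-assoc 1 1+b≤1+M) ⟩
    m ∸ suc b                    ≡⟨ cong (_∸ suc b) (sym (+-identityʳ m)) ⟩
    m + 0 ∸ suc b                ≡⟨ sym (offset-> {b = suc b} (s≤s z≤n)) ⟩
    offset 0 (suc b)             ∎
    where
    open ≡-Reasoning
    b = toℕ j
    1+b≤1+M : suc b ≤ suc M
    1+b≤1+M = s≤s⁻¹ (Fin.toℕ<n (suc j))
  offset-prev {suc i} {j} i≢j rewrite Fin.toℕ-inject₁ i with ≤-<-connex (toℕ j) (toℕ i)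
  ... | inj₁ b≤a = begin
    suc (offset a b) ≡⟨ cong suc (offset-≤ b≤a) ⟩
    suc (a ∸ b)      ≡⟨ sym (+-∸-assoc 1 b≤a) ⟩
    suc a ∸ b        ≡⟨ sym (offset-≤ (m≤n⇒m≤1+n b≤a)) ⟩
    offset (suc a) b ∎
    where
    open ≡-Reasoning
    a = toℕ i
    b = toℕ j
  ... | inj₂ a<b = begin
    suc (offset a b) ≡⟨ cong suc (offset-> a<b) ⟩
    suc (m + a ∸ b)  ≡⟨ sym (+-∸-assoc 1 b≤m+a) ⟩
    suc (m + a) ∸ b  ≡⟨ cong (_∸ b) (sym (+-suc m a)) ⟩
    m + suc a ∸ b    ≡⟨ sym (offset-> 1+a<b) ⟩
    offset (suc a) b ∎
    where
    open ≡-Reasoning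
    a = toℕ i
    b = toℕ j
    1+a<b : suc a < b
    1+a<b = ≤∧≢⇒< a<b (λ 1+a≡b → i≢j (Fin.toℕ-injective 1+a≡b))
    b≤m+a : b ≤ m + a
    b≤m+a = ≤-trans (<⇒≤ (Fin.toℕ<n j)) (m≤m+n m a)

  len : Fin m → Fin m → ℕ
  len i j = m + offset (toℕ i) (toℕ j)

  m≤len : ∀ i j → m ≤ len i j
  m≤len i j = m≤m+n m _

  len<K : ∀ i j → len i j < K
  len<K i j = +-monoʳ-< m (offset<m (toℕ j) (Fin.toℕ<n i))

  len-prev : ∀ {i j} → i ≢ j → suc (len (prev i) j) ≡ len i j
  len-prev {i} {j} i≢j = trans (sym (+-suc m _)) (cong (m +_) (offset-prev i≢j))

  -- path i j is a chain centre j — path i j 0 — path i j 1 — ⋯ of all K vertices; hub i is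
  -- attached at path i j (len i j − 2), so it lies at distance len i j from centre j, and the
  -- rest of the chain is a dangling tail.
  data Edge : V → V → Set where
    leaf-centre : ∀ {j t} → Edge (leaf j t) (centre j)
    centre-path : ∀ {i j} → Edge (centre j) (path i j zero)
    path-path   : ∀ {i j k k′} → toℕ k′ ≡ suc (toℕ k) → Edge (path i j k) (path i j k′)
    path-hub    : ∀ {i j k} → suc (suc (toℕ k)) ≡ len i j → Edge (path i j k) (hub i)

  Edge-irrefl : ∀ {u} → ¬ Edge u u
  Edge-irrefl (path-path k≡1+k) = 1+n≢n (sym k≡1+k)

  edge? : ∀ u u′ → Dec (Edge u u′)
  edge? (leaf j t) (centre j′) with j Fin.≟ j′
  ... | yes refl = yes leaf-centre
  ... | no  j≢j′ = no λ { leaf-centre → j≢j′ refl }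
  edge? (centre j) (path i j′ k) with j Fin.≟ j′ | k Fin.≟ zero
  ... | yes refl | yes refl = yes centre-path
  ... | no  j≢j′ | _        = no λ { centre-path → j≢j′ refl }
  ... | _        | no  k≢0  = no λ { centre-path → k≢0 refl }
  edge? (path i j k) (path i′ j′ k′) with i Fin.≟ i′ | j Fin.≟ j′ | toℕ k′ ℕ.≟ suc (toℕ k)
  ... | yes refl | yes refl | yes k′≡1+k = yes (path-path k′≡1+k)
  ... | no  i≢i′ | _        | _          = no λ { (path-path _) → i≢i′ refl }
  ... | _        | no  j≢j′ | _          = no λ { (path-path _) → j≢j′ refl }
  ... | _        | _        | no  k′≢1+k = no λ { (path-path k′≡1+k) → k′≢1+k k′≡1+k }
  edge? (path i j k) (hub i′) with i Fin.≟ i′ | suc (suc (toℕ k)) ℕ.≟ len i j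
  ... | yes refl | yes at-hub  = yes (path-hub at-hub)
  ... | no  i≢i′ | _           = no λ { (path-hub _) → i≢i′ refl }
  ... | _        | no  ¬at-hub = no λ { (path-hub at-hub) → ¬at-hub at-hub }
  edge? (leaf _ _)   (leaf _ _)   = no λ ()
  edge? (leaf _ _)   (hub _)      = no λ ()
  edge? (leaf _ _)   (path _ _ _) = no λ ()
  edge? (centre _)   (leaf _ _)   = no λ ()
  edge? (centre _)   (centre _)   = no λ ()
  edge? (centre _)   (hub _)      = no λ ()
  edge? (hub _)      _            = no λ ()
  edge? (path _ _ _) (leaf _ _)   = no λ ()
  edge? (path _ _ _) (centre _)   = no λ ()

  G : Graph n
  G = record
    { adj    = λ x y → does (edge? (dec x) (dec y)) ∨ does (edge? (dec y) (dec x))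
    ; sym    = λ x y → ∨-comm (does (edge? (dec x) (dec y))) _
    ; irrefl = λ x → cong (λ b → b ∨ b) (dec-false (edge? (dec x) (dec x)) Edge-irrefl)
    }

  Edge⇒adj : ∀ {u u′} → Edge u u′ → adj G (enc u) (enc u′) ≡ true
  Edge⇒adj {u} {u′} e rewrite dec-enc u | dec-enc u′ | dec-true (edge? u u′) e = refl

  adj⇒Edge : ∀ {x y} → adj G x y ≡ true → Edge (dec x) (dec y) ⊎ Edge (dec y) (dec x)
  adj⇒Edge {x} {y} x~y with edge? (dec x) (dec y) | edge? (dec y) (dec x)
  ... | yes e | _     = inj₁ e
  ... | no  _ | yes e = inj₂ e

  path-walk : ∀ {i j} d (k : Fin K) → suc (suc (toℕ k)) + d ≡ len i j →
              Walk G (enc (path i j k)) (enc (hub i)) (suc d)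
  path-walk {i} {j} zero k k≡len =
    step (Edge⇒adj (path-hub {i} {j} {k} (trans (sym (+-identityʳ _)) k≡len))) here
  path-walk {i} {j} (suc d) k k+d≡len =
    step (Edge⇒adj (path-path {i} {j} {k} (Fin.toℕ-fromℕ< 1+k<K))) (path-walk {i} {j} d (fromℕ< 1+k<K) k′+d≡len)
    where
    1+k<K : suc (toℕ k) < K
    1+k<K = ≤-trans (m≤m+n _ (suc d)) (≤-trans (≤-reflexive k+d≡len) (<⇒≤ (len<K i j)))
    k′+d≡len : suc (suc (toℕ (fromℕ< 1+k<K))) + d ≡ len i j
    k′+d≡len = begin
      suc (suc (toℕ (fromℕ< 1+k<K))) + d ≡⟨ cong (λ x → suc (suc x) + d) (Fin.toℕ-fromℕ< 1+k<K) ⟩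
      suc (suc (suc (toℕ k))) + d        ≡⟨ sym (+-suc (suc (suc (toℕ k))) d) ⟩
      suc (suc (toℕ k)) + suc d          ≡⟨ k+d≡len ⟩
      len i j                            ∎
      where open ≡-Reasoning

  leaf-walk : ∀ j t i → Walk G (enc (leaf j t)) (enc (hub i)) (suc (len i j))
  leaf-walk j t i =
    step {w = enc (centre j)} (Edge⇒adj {leaf j t} {centre j} leaf-centre)
      (step {w = enc (path i j zero)} (Edge⇒adj {centre j} {path i j zero} centre-path)
        (path-walk {i} {j} _ zero refl))

  gap : Fin m → Fin m → ℕ
  gap j j′ with j Fin.≟ j′
  ... | yes _ = 0
  ... | no  _ = K

  gap-refl : ∀ j → gap j j ≡ 0
  gap-refl j with j Fin.≟ j
  ... | yes _   = refl
  ... | no  j≢j = ⊥-elim (j≢j refl)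

  gap-≢ : ∀ {j j′} → j ≢ j′ → gap j j′ ≡ K
  gap-≢ {j} {j′} j≢j′ with j Fin.≟ j′
  ... | yes j≡j′ = ⊥-elim (j≢j′ j≡j′)
  ... | no  _    = refl

  gap≤K : ∀ j j′ → gap j j′ ≤ K
  gap≤K j j′ with j Fin.≟ j′
  ... | yes _ = z≤n
  ... | no  _ = ≤-refl

  len≤len+gap : ∀ i j j′ → len i j ≤ len i j′ + gap j j′
  len≤len+gap i j j′ with j Fin.≟ j′
  ... | yes refl = ≤-reflexive (sym (+-identityʳ (len i j)))
  ... | no  _    = ≤-trans (<⇒≤ (len<K i j)) (m≤n+m K (len i j′))

  -- A lower bound for the distance from centre j: the first argument of ⊓ bounds walks that
  -- reach path i j′ k through centre j′, the second those through hub i.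
  potential : Fin m → V → ℕ
  potential j (leaf j′ _)   = gap j j′
  potential j (centre j′)   = gap j j′
  potential j (hub i)       = len i j
  potential j (path i j′ k) = (suc (toℕ k) + gap j j′) ⊓ (len i j + (len i j′ ∸ suc (toℕ k)))

  potential-Near : ∀ j {u u′} → Edge u u′ → Near (potential j u) (potential j u′)
  potential-Near j {leaf j′ _} leaf-centre = Near-refl (gap j j′)
  potential-Near j {centre j′} {path i _ _} centre-path =
    ⊓-glb (m≤n⇒m≤1+n (n≤1+n _)) (begin
      gap j j′                   ≤⟨ gap≤K j j′ ⟩
      m + m                      ≤⟨ +-mono-≤ (m≤len i j) (m≤len i j′) ⟩
      len i j + len i j′         ≡⟨ +-suc (len i j) _ ⟩
      suc (len i j + (len i j′ ∸ 1)) ∎) ,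
    m⊓n≤m _ _
    where open ≤-Reasoning
  potential-Near j {path i j′ k} (path-path k′≡1+k) rewrite k′≡1+k =
    Near-⊓ (Near-suc _) (Near-+ˡ (len i j) (Near-∸-suc (len i j′) (suc (toℕ k))))
  potential-Near j {path i j′ k} (path-hub k≡len)
    rewrite trans (cong (_∸ suc (toℕ k)) (sym k≡len)) (m+n∸n≡m 1 (suc (toℕ k))) =
    ≤-trans (m⊓n≤n _ _) (≤-reflexive (+-comm (len i j) 1)) ,
    ⊓-glb {y = suc (suc (toℕ k) + gap j j′)} {z = suc (len i j + 1)}
          (≤-trans (len≤len+gap i j j′) (≤-reflexive (cong (_+ gap j j′) (sym k≡len))))
          (≤-trans (m≤m+n (len i j) 1) (n≤1+n _))

  potential-Lipschitz : ∀ j → Lipschitz G (potential j ∘ dec)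
  potential-Lipschitz j {x} {y} x~y with adj⇒Edge {x} {y} x~y
  ... | inj₁ e = proj₂ (potential-Near j e)
  ... | inj₂ e = proj₁ (potential-Near j e)

  leaf-neighbour : ∀ {j t y} → adj G (enc (leaf j t)) y ≡ true → dec y ≡ centre j
  leaf-neighbour {j} {t} {y} v~y with adj⇒Edge {enc (leaf j t)} {y} v~y
  ... | inj₁ e rewrite dec-enc (leaf j t) = from-leaf e
    where
    from-leaf : ∀ {u} → Edge (leaf j t) u → u ≡ centre j
    from-leaf leaf-centre = refl
  ... | inj₂ e rewrite dec-enc (leaf j t) = ⊥-elim (into-leaf e)
    where
    into-leaf : ∀ {u} → ¬ Edge u (leaf j t)
    into-leaf ()

  answer : V → Fin m
  answer (leaf j _)   = j
  answer (centre j)   = j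
  answer (hub i)      = prev i
  answer (path i _ _) = prev i

  spoiled : V → Fin m × Fin m
  spoiled (leaf j _)    = j , j
  spoiled (centre j)    = j , j
  spoiled (hub i)       = i , i
  spoiled (path i j′ _) = i , j′

  answer-bound : ∀ j u → j ≢ proj₁ (spoiled u) → j ≢ proj₂ (spoiled u) →
                 suc (len (answer u) j) ≤ potential j u
  answer-bound j (leaf j′ _)   j≢j′ _ rewrite gap-≢ j≢j′ = len<K j′ j
  answer-bound j (centre j′)   j≢j′ _ rewrite gap-≢ j≢j′ = len<K j′ j
  answer-bound j (hub i)       j≢i  _ = ≤-reflexive (len-prev (j≢i ∘ sym))
  answer-bound j (path i j′ k) j≢i j≢j′ rewrite len-prev (j≢i ∘ sym) | gap-≢ j≢j′ =
    ⊓-glb (≤-trans (<⇒≤ (len<K i j)) (m≤n+m K (suc (toℕ k)))) (m≤m+n (len i j) (len i j′ ∸ suc (toℕ k)))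

  β : Fin n → Fin n
  β a = enc (hub (answer (dec a)))

  β≢ : ∀ a → β a ≢ a
  β≢ a βa≡a with dec a | trans (sym (dec-enc (hub (answer (dec a))))) (cong dec βa≡a)
  ... | leaf _ _   | ()
  ... | centre _   | ()
  ... | hub i      | hub-prev≡hub = prev≢ i (hub-injective hub-prev≡hub)
    where
    hub-injective : ∀ {i i′} → hub i ≡ hub i′ → i ≡ i′
    hub-injective refl = refl
  ... | path _ _ _ | ()

  open Answering G β β≢ (enc (centre zero)) public

  leaf-beats : ∀ {j t a} → j ≢ proj₁ (spoiled (dec a)) → j ≢ proj₂ (spoiled (dec a)) →
               Beats (enc (leaf j t)) a
  leaf-beats {j} {t} {a} j≢s₁ j≢s₂ =
    suc (len (answer (dec a)) j) , leaf-walk j t _ ,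
    DistGt-mono G (answer-bound j (dec a) j≢s₁ j≢s₂)
      (Lipschitz⇒DistGt G {potential j ∘ dec} {enc (leaf j t)} {a}
        (λ {x} {y} → potential-Lipschitz j {x} {y}) potential≡0 a≢v)
    where
    potential≡0 : ∀ y → adj G (enc (leaf j t)) y ≡ true → potential j (dec y) ≡ 0
    potential≡0 y v~y = trans (cong (potential j) (leaf-neighbour {j} {t} {y} v~y)) (gap-refl j)
    a≢v : a ≢ enc (leaf j t)
    a≢v refl = j≢s₁ (cong (proj₁ ∘ spoiled) (sym (dec-enc (leaf j t))))

  open DecMembership (Fin._≟_ {m}) using () renaming (_∈?_ to _∈ᶜ?_)

  spoiledClusters : List (Fin n) → List (Fin m)
  spoiledClusters As = map (proj₁ ∘ spoiled ∘ dec) As ++ map (proj₂ ∘ spoiled ∘ dec) As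

  intactClusters : List (Fin n) → List (Fin m)
  intactClusters As = filter (λ j → ¬? (j ∈ᶜ? spoiledClusters As)) (allFin m)

  intactLeaves : List (Fin n) → List (Fin n)
  intactLeaves As = cartesianProductWith (λ j t → enc (leaf j t)) (intactClusters As) (allFin N)

  intactLeaves-Unique : ∀ As → Unique (intactLeaves As)
  intactLeaves-Unique As = Unique.cartesianProductWith⁺ _ leaf-injective
    (Unique.filter⁺ (λ j → ¬? (j ∈ᶜ? spoiledClusters As)) (Unique.allFin⁺ m)) (Unique.allFin⁺ N)
    where
    leaf-injective : ∀ {j j′ t t′} → enc (leaf j t) ≡ enc (leaf j′ t′) → j ≡ j′ × t ≡ t′
    leaf-injective {j} {j′} {t} {t′} eq with enc-injective {leaf j t} {leaf j′ t′} eq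
    ... | refl = refl , refl

  length-intactLeaves : ∀ As → (m ∸ (length As + length As)) * N ≤ length (intactLeaves As)
  length-intactLeaves As = begin
    (m ∸ (length As + length As)) * N          ≡⟨ cong (λ l → (l ∸ (length As + length As)) * N) (sym (length-tabulate id)) ⟩
    (length (allFin m) ∸ (length As + length As)) * N
      ≡⟨ cong (λ s → (length (allFin m) ∸ s) * N) (sym length-spoiled) ⟩
    (length (allFin m) ∸ length (spoiledClusters As)) * N
      ≤⟨ *-monoˡ-≤ N (length∸≤length-filter-∉ Fin._≟_ (spoiledClusters As) (Unique.allFin⁺ m)) ⟩
    length (intactClusters As) * N             ≡⟨ cong (length (intactClusters As) *_) (sym (length-tabulate id)) ⟩
    length (intactClusters As) * length (allFin N)
      ≡⟨ sym (length-cartesianProductWith _ (intactClusters As) (allFin N)) ⟩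
    length (intactLeaves As)                   ∎
    where
    open ≤-Reasoning
    length-spoiled : length (spoiledClusters As) ≡ length As + length As
    length-spoiled = trans (length-++ (map (proj₁ ∘ spoiled ∘ dec) As))
                           (cong₂ _+_ (length-map _ As) (length-map _ As))

  ∉spoiled⇒≢ : ∀ {j a As} → j ∉ spoiledClusters As → a ∈ As →
               j ≢ proj₁ (spoiled (dec a)) × j ≢ proj₂ (spoiled (dec a))
  ∉spoiled⇒≢ {As = As} j∉ a∈ =
    (λ { refl → j∉ (∈-++⁺ˡ (∈-map⁺ (proj₁ ∘ spoiled ∘ dec) a∈)) }) ,
    (λ { refl → j∉ (∈-++⁺ʳ (map (proj₁ ∘ spoiled ∘ dec) As) (∈-map⁺ (proj₂ ∘ spoiled ∘ dec) a∈)) })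

  intactLeaves-StrictlyCloser : ∀ {h a} → Reachable σ h → let h′ = (a , σ h a) ∷ h in
    All (StrictlyCloser G (claimedB h′) (claimedA h′)) (intactLeaves (claimedA h′))
  intactLeaves-StrictlyCloser {h} {a} R = All.tabulate λ v∈ →
    let (j , t , j∈ , _ , v≡) = ∈-cartesianProductWith⁻ _ (intactClusters As) (allFin N) v∈
        j∉ = proj₂ (∈-filter⁻ (λ j → ¬? (j ∈ᶜ? spoiledClusters As)) {xs = allFin m} j∈)
    in subst (StrictlyCloser G _ _) (sym v≡)
         (BAhead⇒StrictlyCloser _ (BAhead-reachable _ R
           (All.tabulate λ a∈ → uncurry leaf-beats (∉spoiled⇒≢ j∉ a∈))))
    where As = claimedA ((a , σ h a) ∷ h)

  m≤n : m ≤ n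
  m≤n = ≤-trans (≤-reflexive (sym (*-identityʳ m))) (*-monoʳ-≤ m (≤-trans (s≤s z≤n) (m≤n+m Q N)))

  intactLeaves-fraction : ∀ p q .{{_ : NonZero q}} As → 1 ≤ p → q * suc (length As + length As) ≤ m →
                          q * n ≤ q * length (intactLeaves As) + p * n
  intactLeaves-fraction p q As 1≤p q[1+T]≤m = begin
    q * n                                         ≡⟨ cong (q *_) n≡[1+m]*N ⟩
    q * (suc m * N)                               ≤⟨ leaf-fraction p q m T N 1≤p T≤m (m≤n⇒m≤1+n q[1+T]≤m) ⟩
    q * ((m ∸ T) * N) + p * (suc m * N)           ≤⟨ +-monoˡ-≤ _ (*-monoʳ-≤ q (length-intactLeaves As)) ⟩
    q * length (intactLeaves As) + p * (suc m * N) ≡⟨ cong (λ x → q * length (intactLeaves As) + p * x)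
                                                       (sym n≡[1+m]*N) ⟩
    q * length (intactLeaves As) + p * n          ∎
    where
    open ≤-Reasoning
    T = length As + length As
    T≤m : T ≤ m
    T≤m = ≤-trans (n≤1+n T) (≤-trans (m≤n*m (suc T) q) q[1+T]≤m)
    n≡[1+m]*N : n ≡ suc m * N
    n≡[1+m]*N = distrib m Q
      where
      distrib : ∀ m Q → m * (m * Q + Q) ≡ (1 + m) * (m * Q)
      distrib = ℕ-Solver.solve-∀

theorem3 : (t₀ : ℕ) → 1 ≤ t₀ → (ε : ℚ) → Positive ε →
    ∃[ n ] ∃[ G ] ∃[ σ ]
      (2 * t₀ ≤ n ×
       (∀ h a → Reachable {n} σ h → length h < t₀ → ¬ Claimed h a →
          (¬ Claimed h (σ h a)) × (σ h a ≢ a) ×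
          BControlsAtLeast {n} G ε ((a , σ h a) ∷ h)))
theorem3 t₀ _ ε ε>0 = n , G , σ , 2t₀≤n , λ h a R h<t₀ a-free →
  let As = claimedA ((a , σ h a) ∷ h)
      (σ-free , σ≢a) = σ-legal h a (short-history-fits {h} h<t₀) a-free
  in σ-free , σ≢a , intactLeaves As , intactLeaves-Unique As , intactLeaves-StrictlyCloser R ,
     1-ε-bound ε ε>0 n _ (intactLeaves-fraction _ q As (1≤∣numerator∣ ε ε>0) (short-history-spoils {h} {a} h<t₀))
  where
  q = ℚ.denominatorℕ ε
  open Construction (suc (t₀ + t₀) * q)

  1+2t₀≤m : suc (t₀ + t₀) ≤ m
  1+2t₀≤m = ≤-trans (m≤m*n (suc (t₀ + t₀)) q) (≤-trans (n≤1+n _) (n≤1+n _))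

  2t₀≤n : 2 * t₀ ≤ n
  2t₀≤n = ≤-trans (≤-reflexive (cong (t₀ +_) (+-identityʳ t₀))) (≤-trans (n≤1+n _) (≤-trans 1+2t₀≤m m≤n))

  short-history-fits : ∀ {h : History n} → length h < t₀ → suc (length h + length h) < n
  short-history-fits h<t₀ = ≤-trans (s≤s (+-mono-< h<t₀ h<t₀)) (≤-trans 1+2t₀≤m m≤n)

  short-history-spoils : ∀ {h : History n} {a} → length h < t₀ →
                         let As = claimedA ((a , σ h a) ∷ h) in q * suc (length As + length As) ≤ m
  short-history-spoils {h} {a} h<t₀ = begin
    q * suc (length As + length As) ≤⟨ *-monoʳ-≤ q (s≤s (+-mono-≤ |As|≤t₀ |As|≤t₀)) ⟩
    q * suc (t₀ + t₀)               ≡⟨ *-comm q _ ⟩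
    suc (t₀ + t₀) * q               ≤⟨ ≤-trans (n≤1+n _) (n≤1+n _) ⟩
    m                               ∎
    where
    open ≤-Reasoning
    As = claimedA ((a , σ h a) ∷ h)
    |As|≤t₀ : length As ≤ t₀
    |As|≤t₀ = ≤-trans (≤-reflexive (cong suc (length-map proj₁ h))) h<t₀
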